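{- Let $n,k$ be positive integers with $n\ge 2k$ and $\gcd(n,k)=1$. Fix $X_0\in V(Q(n,k))$ and identify each vertex $\rho^t(X_0)$ ($0\le t\le n-1$) of $Q(n,k)$ with the element $t+1\in[n]$ (the natural representation of $Q(n,k)$ along a base cycle $C_n$). Then every maximum independent set of $Q(n,k)$ corresponds under this identification to a well-spread subset of $[n]$.
   Context: For a positive integer $n$ let $[n]=\{1,\dots,n\}$ and let $C_n$ be the cycle on $[n]$ with edges $\{i,i+1\}$ ($1\le i\le n-1$) and $\{n,1\}$. The Schrijver graph $\mathrm{SG}(n,k)$ ($n\ge 2k$) has as vertices the $k$-subsets of $[n]$ containing no two cyclically consecutive elements, two vertices adjacent iff they are disjoint. An arc of $C_n$ is a set $\{i,i+1,\dots,i+m-1\}$ (addition mod $n$) with $1\le m\le n-1$. A set $U\subseteq[n]$ is well-spread if for any two arcs $A,B$ with $|A|=|B|$ we have $\big||A\cap U|-|B\cap U|\big|\le 1$. $Q(n,k)$ is the induced subgraph of $\mathrm{SG}(n,k)$ on all well-spread $k$-subsets of $[n]$. $\rho:[n]\to[n]$ is the rotation $i\mapsto i+1$ (mod $n$), acting on subsets elementwise; when $\gcd(n,k)=1$ the vertices of $Q(n,k)$ are exactly $\rho^t(X_0)$, $0\le t\le n-1$, and these are pairwise distinct. -}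

module Defs where

open import Data.Nat using (ℕ; zero; suc; _+_; _∸_; _≤_; _*_)
open import Data.Nat.DivMod using (_mod_)
open import Data.Bool using (Bool; true; false; if_then_else_)
open import Data.Fin using (Fin; toℕ)
open import Data.Fin.Subset using (Subset; ∣_∣)
open import Data.Vec using (tabulate; lookup)
open import Data.List using (List)
open import Data.List.Membership.Propositional using (_∈_)
open import Data.List.Relation.Unary.Unique.Propositional using (Unique)
open import Data.Product using (_×_)
open import Relation.Binary.PropositionalEquality using (_≡_; _≢_)
open import Relation.Nullary using (¬_)
open import Function using (_⇔_)

-- Convention: the ground set [n] = {1,…,n} is represented by Fin n,
-- the element i+1 ∈ [n] corresponding to i : Fin n.  A subset of [n]
-- is a characteristic vector (Subset n = Vec Bool n).

at : {n : ℕ} → Subset n → ℕ → Bool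
at {zero}  U x = false
at {suc n} U x = lookup U (x mod suc n)

-- the rotation ρ : i ↦ i+1 (mod n), acting on subsets elementwise:
-- j ∈ ρ U  iff  j - 1 ≡ j + (n - 1) (mod n) ∈ U
ρ : {n : ℕ} → Subset n → Subset n
ρ {n} U = tabulate (λ j → at U (toℕ j + (n ∸ 1)))

ρ^ : {n : ℕ} → ℕ → Subset n → Subset n
ρ^ zero    U = U
ρ^ (suc t) U = ρ (ρ^ t U)

arcCount : {n : ℕ} → Subset n → ℕ → ℕ → ℕ
arcCount U i zero    = 0
arcCount U i (suc m) = (if at U (i + m) then 1 else 0) + arcCount U i m

WellSpread : {n : ℕ} → Subset n → Set
WellSpread {n} U = (i j : Fin n) (m : ℕ) → 1 ≤ m → m ≤ n ∸ 1 →
  (arcCount U (toℕ i) m ≤ arcCount U (toℕ j) m + 1)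
  × (arcCount U (toℕ j) m ≤ arcCount U (toℕ i) m + 1)

SGVertex : (n k : ℕ) → Subset n → Set
SGVertex n k U = (∣ U ∣ ≡ k)
  × ((i : Fin n) → ¬ ((at U (toℕ i) ≡ true) × (at U (toℕ i + 1) ≡ true)))

QVertex : (n k : ℕ) → Subset n → Set
QVertex n k U = SGVertex n k U × WellSpread U

-- adjacency in SG(n,k) (hence in the induced subgraph Q(n,k)): disjointness
Disjoint : {n : ℕ} → Subset n → Subset n → Set
Disjoint {n} X Y = (i : Fin n) → ¬ ((at X (toℕ i) ≡ true) × (at Y (toℕ i) ≡ true))

IndepQ : (n k : ℕ) → List (Subset n) → Set
IndepQ n k L = Unique L
  × (∀ {X} → X ∈ L → QVertex n k X)
  × (∀ {X Y} → X ∈ L → Y ∈ L → X ≢ Y → ¬ Disjoint X Y)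

MaxIndepQ : (n k : ℕ) → List (Subset n) → Set
MaxIndepQ n k L = IndepQ n k L
  × (∀ (L' : List (Subset n)) → IndepQ n k L' → Data.List.length L' ≤ Data.List.length L)

-- T ⊆ [n] is the image of the vertex set L under the identification
-- ρ^t(X₀) ↦ t+1 (i.e. t : Fin n ∈ T iff ρ^t X₀ ∈ L)
Corresponds : {n : ℕ} → Subset n → List (Subset n) → Subset n → Set
Corresponds {n} X₀ L T = (t : Fin n) → (t Data.Fin.Subset.∈ T) ⇔ (ρ^ (toℕ t) X₀ ∈ L)

-- Write n = k + K.  A well-spread k-subset of ℤ/n is mechanical, U = {x : (c + x·K) mod n < k}
-- (a potential-function argument), and conversely every such set is a vertex of Q(n,k):
-- reflected it becomes {x : (e + x·k) mod n < k}, whose arcs of length m hold ⌊(a + m·k)/n⌋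
-- points.  As gcd(n, k) = 1 the intercept c is determined mod n, rotation by t adds t·k to it,
-- and two vertices meet iff their intercepts are at cyclic distance < k.  The k vertices
-- containing 0 show that a maximum independent set has at least k members; their intercepts are
-- pairwise closer than k, and counting forces such a set of residues to be an arc of length k.
-- Pulled back along t ↦ c₀ + t·k this arc is {t : (e + t·k) mod n < k}, mechanical again and
-- hence well-spread.

module Submission where

open import Defs
import Algebra.Properties.CommutativeSemigroup as CommutativeSemigroupProperties
open import Data.Bool using (Bool; true; false; if_then_else_)
import Data.Bool as Bool
open import Data.Bool.Properties using (T-≡; ¬-not)
open import Data.Empty using (⊥; ⊥-elim)
open import Data.Fin using (Fin; toℕ; fromℕ<) renaming (zero to fzero; suc to fsuc)
open import Data.Fin.Properties using (toℕ<n; fromℕ<-cong; fromℕ<-toℕ; toℕ-fromℕ<)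
open import Data.Fin.Subset using (Subset; ∣_∣) renaming (_∈_ to _∈ₛ_)
open import Data.List using (List; []; _∷_; _++_; [_]; length; upTo; filter; map; applyUpTo)
open import Data.List.Extrema.Nat using (argmin; argmin-all; f[argmin]≤f[xs])
open import Data.List.Membership.Propositional using (_∈_; find; lose)
open import Data.List.Membership.Propositional.Properties
  using (∈-∃++; ∈-++⁺ˡ; ∈-++⁺ʳ; ∈-++⁻; ∈-upTo⁺; ∈-upTo⁻; ∈-filter⁺; ∈-filter⁻; ∈-map⁺; ∈-applyUpTo⁻)
import Data.List.Membership.DecPropositional as DecMembership
open import Data.List.Properties using (length-++; length-map; length-applyUpTo; length-upTo)
open import Data.List.Relation.Unary.All as All using (All)
open import Data.List.Relation.Unary.AllPairs using (_∷_)
open import Data.List.Relation.Unary.Any as Any using (Any; any?; here; there)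
open import Data.List.Relation.Unary.Unique.Propositional using (Unique)
open import Data.List.Relation.Unary.Unique.Propositional.Properties using (filter⁺; upTo⁺; applyUpTo⁺₁)
open import Data.Nat
open import Data.Nat.Coprimality using (Coprime; coprime-Bézout; gcd≡1⇒coprime)
open import Data.Nat.DivMod
open import Data.Nat.Divisibility using (_∣_; divides-refl; ∣-refl; ∣m+n∣m⇒∣n; ∣m∣n⇒∣m+n)
open import Data.Nat.GCD using (gcd; module Bézout)
open import Data.Nat.Properties
open import Data.Nat.Tactic.RingSolver using (solve-∀)
open import Data.Product using (∃-syntax; _×_; _,_; proj₁; proj₂)
open import Data.Sum using (_⊎_; inj₁; inj₂; [_,_]′)
open import Data.Vec using (Vec; []; _∷_; lookup; tabulate)
open import Data.Vec.Properties using (lookup∘tabulate; tabulate∘lookup; tabulate-cong; ≡-dec; lookup⇒[]=; []=⇒lookup)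
open import Function using (_∘_; id; _⇔_; mk⇔; Equivalence)
open import Function.Properties.Equivalence using (⇔-setoid) renaming (sym to ⇔-sym)
open import Level using (0ℓ)
open import Relation.Binary.Bundles using (Setoid)
open import Relation.Binary.PropositionalEquality hiding ([_])
import Relation.Binary.Reasoning.Setoid as SetoidReasoning
open import Relation.Nullary using (¬_; contradiction; yes; no)
open import Relation.Unary using (Decidable)

module +-CS = CommutativeSemigroupProperties +-commutativeSemigroup
module ⇔-Reasoning = SetoidReasoning (⇔-setoid 0ℓ)

bit : Bool → ℕ
bit b = if b then 1 else 0

∑ : ℕ → (ℕ → ℕ) → ℕ
∑ zero    f = 0
∑ (suc m) f = ∑ m f + f m

∑-cong : ∀ m {f g} → (∀ i → i < m → f i ≡ g i) → ∑ m f ≡ ∑ m g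
∑-cong zero    f≡g = refl
∑-cong (suc m) f≡g = cong₂ _+_ (∑-cong m (λ i i<m → f≡g i (m<n⇒m<1+n i<m))) (f≡g m ≤-refl)

∑-mono-≤ : ∀ m {f g} → (∀ i → i < m → f i ≤ g i) → ∑ m f ≤ ∑ m g
∑-mono-≤ zero    f≤g = z≤n
∑-mono-≤ (suc m) f≤g = +-mono-≤ (∑-mono-≤ m (λ i i<m → f≤g i (m<n⇒m<1+n i<m))) (f≤g m ≤-refl)

∑-mono-< : ∀ m {f g j} → (∀ i → i < m → f i ≤ g i) → j < m → f j < g j → ∑ m f < ∑ m g
∑-mono-< (suc m) {j = j} f≤g j<1+m fj<gj with m<1+n⇒m<n∨m≡n j<1+m
... | inj₁ j<m  = +-mono-<-≤ (∑-mono-< m (λ i i<m → f≤g i (m<n⇒m<1+n i<m)) j<m fj<gj) (f≤g m ≤-refl)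
... | inj₂ refl = +-mono-≤-< (∑-mono-≤ m (λ i i<m → f≤g i (m<n⇒m<1+n i<m))) fj<gj

∑-distrib-+ : ∀ m f g → ∑ m (λ i → f i + g i) ≡ ∑ m f + ∑ m g
∑-distrib-+ zero    f g = refl
∑-distrib-+ (suc m) f g rewrite ∑-distrib-+ m f g = +-CS.interchange (∑ m f) (∑ m g) (f m) (g m)

∑-const : ∀ m a → ∑ m (λ _ → a) ≡ m * a
∑-const zero    a = refl
∑-const (suc m) a rewrite ∑-const m a = +-comm (m * a) a

∑-comm : ∀ m p (g : ℕ → ℕ → ℕ) → ∑ p (λ i → ∑ m (g i)) ≡ ∑ m (λ j → ∑ p (λ i → g i j))
∑-comm zero    p g = trans (∑-const p 0) (*-zeroʳ p)
∑-comm (suc m) p g =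
  trans (∑-distrib-+ p (λ i → ∑ m (g i)) (λ i → g i m)) (cong (_+ ∑ p (λ i → g i m)) (∑-comm m p g))

∑-suc : ∀ m f → ∑ (suc m) f ≡ f 0 + ∑ m (f ∘ suc)
∑-suc zero    f = +-comm 0 (f 0)
∑-suc (suc m) f rewrite ∑-suc m f = +-assoc (f 0) _ _

∑-periodic : ∀ m f → (∀ i → f (i + m) ≡ f i) → ∀ c → ∑ m (λ i → f (c + i)) ≡ ∑ m f
∑-periodic m f per zero    = refl
∑-periodic m f per (suc c) = begin
  ∑ m (λ i → f (suc c + i))          ≡⟨ ∑-cong m (λ i _ → cong f (sym (+-suc c i))) ⟩
  ∑ m (λ i → f (c + suc i))          ≡⟨ +-cancelˡ-≡ (f c) _ _ rotate ⟩
  ∑ m (λ i → f (c + i))              ≡⟨ ∑-periodic m f per c ⟩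
  ∑ m f                              ∎
  where
  open ≡-Reasoning
  g : ℕ → ℕ
  g i = f (c + i)
  rotate : f c + ∑ m (g ∘ suc) ≡ f c + ∑ m g
  rotate = begin
    f c + ∑ m (g ∘ suc) ≡⟨ cong (_+ ∑ m (g ∘ suc)) (cong f (+-identityʳ c)) ⟨
    g 0 + ∑ m (g ∘ suc) ≡⟨ ∑-suc m g ⟨
    ∑ m g + g m         ≡⟨ cong (∑ m g +_) (per c) ⟩
    ∑ m g + f c         ≡⟨ +-comm (∑ m g) (f c) ⟩
    f c + ∑ m g         ∎

module _ {A B : Set} where

  private
    ∈-++-remove : ∀ ys₁ {ys₂} {y z : B} → z ∈ ys₁ ++ [ y ] ++ ys₂ → z ≢ y → z ∈ ys₁ ++ ys₂
    ∈-++-remove ys₁ z∈ z≢y with ∈-++⁻ ys₁ z∈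
    ... | inj₁ z∈ys₁         = ∈-++⁺ˡ z∈ys₁
    ... | inj₂ (here z≡y)    = contradiction z≡y z≢y
    ... | inj₂ (there z∈ys₂) = ∈-++⁺ʳ ys₁ z∈ys₂

    length-remove : ∀ ys₁ {ys₂} {y : B} → length (ys₁ ++ [ y ] ++ ys₂) ≡ suc (length (ys₁ ++ ys₂))
    length-remove ys₁ {ys₂} = trans (length-++ ys₁) (trans (+-suc (length ys₁) (length ys₂)) (cong suc (sym (length-++ ys₁))))

  InjectiveOn : (A → B) → List A → Set
  InjectiveOn f xs = ∀ {x y} → x ∈ xs → y ∈ xs → f x ≡ f y → x ≡ y

  length-≤-injection : (f : A → B) {xs : List A} {ys : List B} → Unique xs → InjectiveOn f xs →
                       (∀ {x} → x ∈ xs → f x ∈ ys) → length xs ≤ length ys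
  length-≤-injection f {[]}     _              _   _  = z≤n
  length-≤-injection f {x ∷ xs} (x∉xs ∷ uniq) inj f∈ with ys₁ , ys₂ , refl ← ∈-∃++ (f∈ (here refl)) =
    subst (suc (length xs) ≤_) (sym (length-remove ys₁))
      (s≤s (length-≤-injection f uniq (λ p q → inj (there p) (there q)) f∈ys₁++ys₂))
    where
    f∈ys₁++ys₂ : ∀ {x′} → x′ ∈ xs → f x′ ∈ ys₁ ++ ys₂
    f∈ys₁++ys₂ x′∈ = ∈-++-remove ys₁ (f∈ (there x′∈))
      (λ fx′≡fx → All.lookup x∉xs x′∈ (sym (inj (there x′∈) (here refl) fx′≡fx)))

  length-<-injection : (f : A → B) {xs : List A} {ys : List B} {y : B} → Unique xs → InjectiveOn f xs →
                       (∀ {x} → x ∈ xs → f x ∈ ys) → y ∈ ys → (∀ {x} → x ∈ xs → f x ≢ y) →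
                       length xs < length ys
  length-<-injection f uniq inj f∈ y∈ys fx≢y with ys₁ , ys₂ , refl ← ∈-∃++ y∈ys =
    subst (_ <_) (sym (length-remove ys₁))
      (s≤s (length-≤-injection f uniq inj (λ x∈ → ∈-++-remove ys₁ (f∈ x∈) (fx≢y x∈))))

initial-segment : ∀ {P : ℕ → Set} → Decidable P → ∀ k → (∀ {i j} → i ≤ j → j < k → P j → P i) →
                  ∃[ j ] j ≤ k × (∀ {i} → i < j → P i) × (∀ {i} → j ≤ i → i < k → ¬ P i)
initial-segment P? zero    down = 0 , z≤n , (λ ()) , (λ _ ())
initial-segment {P} P? (suc k) down with P? k
... | yes Pk =
  suc k , ≤-refl , (λ i<1+k → down (s≤s⁻¹ i<1+k) ≤-refl Pk) , (λ 1+k≤i i<1+k → contradiction 1+k≤i (<⇒≱ i<1+k))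
... | no ¬Pk with j , j≤k , below , above ← initial-segment P? k (λ i≤j j<k → down i≤j (m<n⇒m<1+n j<k)) =
  j , m≤n⇒m≤1+n j≤k , below , above′
  where
  above′ : ∀ {i} → j ≤ i → i < suc k → ¬ P i
  above′ j≤i i<1+k with m<1+n⇒m<n∨m≡n i<1+k
  ... | inj₁ i<k  = above j≤i i<k
  ... | inj₂ refl = ¬Pk

module Congruence (n : ℕ) .{{_ : NonZero n}} where

  infix 4 _≈_ _≉_
  record _≈_ (a b : ℕ) : Set where
    constructor mk≈
    field %≡% : a % n ≡ b % n
  open _≈_ public

  _≉_ : ℕ → ℕ → Set
  a ≉ b = ¬ a ≈ b

  ≈-refl : ∀ {a} → a ≈ a
  ≈-refl = mk≈ refl

  ≈-reflexive : ∀ {a b} → a ≡ b → a ≈ b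
  ≈-reflexive refl = ≈-refl

  ≈-sym : ∀ {a b} → a ≈ b → b ≈ a
  ≈-sym (mk≈ eq) = mk≈ (sym eq)

  ≈-trans : ∀ {a b c} → a ≈ b → b ≈ c → a ≈ c
  ≈-trans (mk≈ eq) (mk≈ eq′) = mk≈ (trans eq eq′)

  ≈-setoid : Setoid 0ℓ 0ℓ
  ≈-setoid = record
    { _≈_ = _≈_
    ; isEquivalence = record { refl = ≈-refl ; sym = ≈-sym ; trans = ≈-trans }
    }

  module ≈-Reasoning = SetoidReasoning ≈-setoid

  %-≈ : ∀ a → a % n ≈ a
  %-≈ a = mk≈ (m%n%n≡m%n a n)

  +-≈ : ∀ {a a′ b b′} → a ≈ a′ → b ≈ b′ → a + b ≈ a′ + b′
  +-≈ {a} {a′} {b} {b′} (mk≈ eq) (mk≈ eq′) = mk≈ (begin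
    (a + b) % n             ≡⟨ %-distribˡ-+ a b n ⟩
    (a % n + b % n) % n     ≡⟨ cong₂ (λ x y → (x + y) % n) eq eq′ ⟩
    (a′ % n + b′ % n) % n   ≡⟨ %-distribˡ-+ a′ b′ n ⟨
    (a′ + b′) % n           ∎)
    where open ≡-Reasoning

  *-≈ : ∀ {a a′ b b′} → a ≈ a′ → b ≈ b′ → a * b ≈ a′ * b′
  *-≈ {a} {a′} {b} {b′} (mk≈ eq) (mk≈ eq′) = mk≈ (begin
    (a * b) % n             ≡⟨ %-distribˡ-* a b n ⟩
    (a % n * (b % n)) % n   ≡⟨ cong₂ (λ x y → (x * y) % n) eq eq′ ⟩
    (a′ % n * (b′ % n)) % n ≡⟨ %-distribˡ-* a′ b′ n ⟨
    (a′ * b′) % n           ∎)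
    where open ≡-Reasoning

  +-periodic : ∀ a p → a + p * n ≈ a
  +-periodic a p = mk≈ ([m+kn]%n≡m%n a p n)

  ≈⇒≡ : ∀ {a b} → a < n → b < n → a ≈ b → a ≡ b
  ≈⇒≡ {a} {b} a<n b<n (mk≈ eq) = trans (sym (m<n⇒m%n≡m a<n)) (trans eq (m<n⇒m%n≡m b<n))

  -- b ⊖ a is the residue of b − a.  It is opaque: everything below uses only ⊖<n and +⊖,
  -- and an unfolding ⊖ would stall unification on implicit arguments.
  infixl 6 _⊖_
  opaque
    _⊖_ : ℕ → ℕ → ℕ
    b ⊖ a = (b + (n ∸ a % n)) % n

    ⊖<n : ∀ b a → b ⊖ a < n
    ⊖<n b a = m%n<n (b + (n ∸ a % n)) n

    +⊖ : ∀ a b → a + (b ⊖ a) ≈ b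
    +⊖ a b = begin
      a + (b ⊖ a)                   ≈⟨ +-≈ (≈-sym (%-≈ a)) (%-≈ (b + (n ∸ a % n))) ⟩
      a % n + (b + (n ∸ a % n))     ≡⟨ +-CS.x∙yz≈y∙xz (a % n) b (n ∸ a % n) ⟩
      b + (a % n + (n ∸ a % n))     ≡⟨ cong (b +_) (m+[n∸m]≡n (m%n≤n a n)) ⟩
      b + n                         ≡⟨ cong (b +_) (*-identityˡ n) ⟨
      b + 1 * n                     ≈⟨ +-periodic b 1 ⟩
      b                             ∎
      where open ≈-Reasoning

  +-cancelˡ-≈ : ∀ c {a b} → c + a ≈ c + b → a ≈ b
  +-cancelˡ-≈ c {a} {b} c+a≈c+b = begin
    a                     ≈⟨ +-≈ (+⊖ c 0) (≈-refl {a}) ⟨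
    c + (0 ⊖ c) + a       ≡⟨ cong (_+ a) (+-comm c (0 ⊖ c)) ⟩
    (0 ⊖ c) + c + a       ≡⟨ +-assoc (0 ⊖ c) c a ⟩
    (0 ⊖ c) + (c + a)     ≈⟨ +-≈ (≈-refl {0 ⊖ c}) c+a≈c+b ⟩
    (0 ⊖ c) + (c + b)     ≡⟨ +-assoc (0 ⊖ c) c b ⟨
    (0 ⊖ c) + c + b       ≡⟨ cong (_+ b) (+-comm (0 ⊖ c) c) ⟩
    c + (0 ⊖ c) + b       ≈⟨ +-≈ (+⊖ c 0) (≈-refl {b}) ⟩
    b                     ∎
    where open ≈-Reasoning

  ⊖-unique : ∀ {a b d} → d < n → a + d ≈ b → b ⊖ a ≡ d
  ⊖-unique {a} {b} {d} d<n a+d≈b =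
    ≈⇒≡ (⊖<n b a) d<n (+-cancelˡ-≈ a (≈-trans (+⊖ a b) (≈-sym a+d≈b)))

  ⊖-self : ∀ a → a ⊖ a ≡ 0
  ⊖-self a = ⊖-unique (>-nonZero⁻¹ n) (≈-reflexive (+-identityʳ a))

  ⊖≡0⇒≈ : ∀ {a b} → b ⊖ a ≡ 0 → a ≈ b
  ⊖≡0⇒≈ {a} {b} eq = ≈-trans (≈-reflexive (sym (+-identityʳ a))) (subst (λ d → a + d ≈ b) eq (+⊖ a b))

  ⊖+⊖≈0 : ∀ a b → (b ⊖ a) + (a ⊖ b) ≈ 0
  ⊖+⊖≈0 a b = +-cancelˡ-≈ a (begin
    a + ((b ⊖ a) + (a ⊖ b))   ≡⟨ +-assoc a (b ⊖ a) (a ⊖ b) ⟨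
    a + (b ⊖ a) + (a ⊖ b)     ≈⟨ +-≈ (+⊖ a b) (≈-refl {a ⊖ b}) ⟩
    b + (a ⊖ b)               ≈⟨ +⊖ b a ⟩
    a                         ≡⟨ +-identityʳ a ⟨
    a + 0                     ∎)
    where open ≈-Reasoning

  ⊖+⊖ : ∀ {a b} → a ≉ b → (b ⊖ a) + (a ⊖ b) ≡ n
  ⊖+⊖ {a} {b} a≉b with (b ⊖ a) + (a ⊖ b) <? n
  ... | yes s<n = contradiction (⊖≡0⇒≈ (m+n≡0⇒m≡0 _ (≈⇒≡ s<n (>-nonZero⁻¹ n) (⊖+⊖≈0 a b)))) a≉b
  ... | no  s≮n = trans (sym (m∸n+n≡m n≤s)) (cong (_+ n) s∸n≡0)
    where
    s : ℕ
    s = (b ⊖ a) + (a ⊖ b)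
    n≤s : n ≤ s
    n≤s = ≮⇒≥ s≮n
    s∸n<n : s ∸ n < n
    s∸n<n = subst (s ∸ n <_) (m+n∸n≡m n n) (∸-monoˡ-< (+-mono-< (⊖<n b a) (⊖<n a b)) n≤s)
    s∸n≡0 : s ∸ n ≡ 0
    s∸n≡0 = ≈⇒≡ s∸n<n (>-nonZero⁻¹ n) (begin
      s ∸ n           ≈⟨ +-periodic (s ∸ n) 1 ⟨
      s ∸ n + 1 * n   ≡⟨ cong (s ∸ n +_) (*-identityˡ n) ⟩
      s ∸ n + n       ≡⟨ m∸n+n≡m n≤s ⟩
      s               ≈⟨ ⊖+⊖≈0 a b ⟩
      0               ∎)
      where open ≈-Reasoning

  ⊖-cong : ∀ {a a′ b b′} → a ≈ a′ → b ≈ b′ → b ⊖ a ≡ b′ ⊖ a′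
  ⊖-cong {a} {a′} {b} {b′} a≈a′ b≈b′ =
    sym (⊖-unique (⊖<n b a) (≈-trans (+-≈ (≈-sym a≈a′) (≈-refl {b ⊖ a})) (≈-trans (+⊖ a b) b≈b′)))

  ⊖-+ : ∀ a b z → (b + z) ⊖ (a + z) ≡ b ⊖ a
  ⊖-+ a b z = ⊖-unique (⊖<n b a) (begin
    a + z + (b ⊖ a)     ≡⟨ +-CS.xy∙z≈xz∙y a z (b ⊖ a) ⟩
    a + (b ⊖ a) + z     ≈⟨ +-≈ (+⊖ a b) (≈-refl {z}) ⟩
    b + z               ∎)
    where open ≈-Reasoning

  ⊖-≤ : ∀ {a b} → a ≤ b → b < n → b ⊖ a ≡ b ∸ a
  ⊖-≤ {a} {b} a≤b b<n = ⊖-unique (≤-<-trans (m∸n≤m b a) b<n) (≈-reflexive (m+[n∸m]≡n a≤b))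

  +-0⊖ : ∀ a b → b + (0 ⊖ a) ≈ b ⊖ a
  +-0⊖ a b = +-cancelˡ-≈ a (begin
    a + (b + (0 ⊖ a))   ≡⟨ +-CS.x∙yz≈y∙xz a b (0 ⊖ a) ⟩
    b + (a + (0 ⊖ a))   ≈⟨ +-≈ (≈-refl {b}) (+⊖ a 0) ⟩
    b + 0               ≡⟨ +-identityʳ b ⟩
    b                   ≈⟨ +⊖ a b ⟨
    a + (b ⊖ a)         ∎)
    where open ≈-Reasoning

  unit-inverse : ∀ {s} → Coprime n s → ∃[ y ] y * s ≈ 1
  unit-inverse {s} cop with coprime-Bézout cop
  ... | Bézout.-+ x y 1+xn≡ys = y , ≈-trans (≈-reflexive (sym 1+xn≡ys)) (+-periodic 1 x)
  ... | Bézout.+- x y 1+ys≡xn = pred n * y , (begin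
    pred n * y * s                  ≈⟨ +-periodic _ 1 ⟨
    pred n * y * s + 1 * n          ≡⟨ cong (pred n * y * s +_) (trans (*-identityˡ n) (sym (suc-pred n))) ⟩
    pred n * y * s + suc (pred n)   ≡⟨ +-suc _ (pred n) ⟩
    suc (pred n * y * s + pred n)   ≡⟨ cong suc (distrib (pred n) y s) ⟩
    suc (pred n * (1 + y * s))      ≡⟨ cong (λ z → suc (pred n * z)) 1+ys≡xn ⟩
    suc (pred n * (x * n))          ≡⟨ cong suc (*-assoc (pred n) x n) ⟨
    1 + pred n * x * n              ≈⟨ +-periodic 1 (pred n * x) ⟩
    1                               ∎)
    where
    open ≈-Reasoning
    distrib : ∀ m y s → m * y * s + m ≡ m * (1 + y * s)
    distrib m y s = trans (cong₂ _+_ (*-assoc m y s) (sym (*-identityʳ m)))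
      (trans (sym (*-distribˡ-+ m (y * s) 1)) (cong (m *_) (+-comm (y * s) 1)))

  unit-surjective : ∀ {s} → Coprime n s → ∀ w → ∃[ x ] x * s ≈ w
  unit-surjective {s} cop w with y , ys≈1 ← unit-inverse cop = w * y , (begin
    w * y * s       ≡⟨ *-assoc w y s ⟩
    w * (y * s)     ≈⟨ *-≈ (≈-refl {w}) ys≈1 ⟩
    w * 1           ≡⟨ *-identityʳ w ⟩
    w               ∎)
    where open ≈-Reasoning

∣∣≡∑ : ∀ {m} (U : Vec Bool m) (g : ℕ → ℕ) → (∀ i → g (toℕ i) ≡ bit (lookup U i)) → ∣ U ∣ ≡ ∑ m g
∣∣≡∑ []          g g≡ = refl
∣∣≡∑ {suc m} (b ∷ U) g g≡ = begin
  ∣ b ∷ U ∣                ≡⟨ ∣b∷U∣ b ⟩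
  bit b + ∣ U ∣            ≡⟨ cong₂ _+_ (sym (g≡ fzero)) (∣∣≡∑ U (g ∘ suc) (g≡ ∘ fsuc)) ⟩
  g 0 + ∑ m (g ∘ suc)      ≡⟨ ∑-suc m g ⟨
  ∑ (suc m) g              ∎
  where
  open ≡-Reasoning
  ∣b∷U∣ : ∀ b → ∣ b ∷ U ∣ ≡ bit b + ∣ U ∣
  ∣b∷U∣ true  = refl
  ∣b∷U∣ false = refl

module Cyclic (n′ : ℕ) where

  n : ℕ
  n = suc n′

  open Congruence n public

  at-≈ : ∀ (U : Subset n) {x y} → x ≈ y → at U x ≡ at U y
  at-≈ U {x} {y} (mk≈ eq) = cong (lookup U) (fromℕ<-cong (x % n) (y % n) eq (m%n<n x n) (m%n<n y n))

  at-toℕ : ∀ (U : Subset n) i → at U (toℕ i) ≡ lookup U i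
  at-toℕ U i = cong (lookup U)
    (trans (fromℕ<-cong (toℕ i % n) (toℕ i) (m<n⇒m%n≡m (toℕ<n i)) (m%n<n (toℕ i) n) (toℕ<n i)) (fromℕ<-toℕ i (toℕ<n i)))

  at-ext : ∀ {Y Z : Subset n} → (∀ x → at Y x ≡ at Z x) → Y ≡ Z
  at-ext {Y} {Z} Y≗Z = begin
    Y                  ≡⟨ tabulate∘lookup Y ⟨
    tabulate (lookup Y) ≡⟨ tabulate-cong (λ i → trans (sym (at-toℕ Y i)) (trans (Y≗Z (toℕ i)) (at-toℕ Z i))) ⟩
    tabulate (lookup Z) ≡⟨ tabulate∘lookup Z ⟩
    Z                  ∎
    where open ≡-Reasoning

  toℕ-mod-≈ : ∀ x → toℕ (x mod n) ≈ x
  toℕ-mod-≈ x = mk≈ (trans (cong (_% n) (toℕ-fromℕ< (m%n<n x n))) (m%n%n≡m%n x n))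

  at-ρ : ∀ (U : Subset n) x → at (ρ U) x ≡ at U (x + n′)
  at-ρ U x = trans (lookup∘tabulate (λ j → at U (toℕ j + n′)) (x mod n))
    (at-≈ U (+-≈ (toℕ-mod-≈ x) (≈-refl {n′})))

  at-ρ^ : ∀ (U : Subset n) t x → at (ρ^ t U) x ≡ at U (x + t * n′)
  at-ρ^ U zero    x = cong (at U) (sym (+-identityʳ x))
  at-ρ^ U (suc t) x = trans (at-ρ (ρ^ t U) x) (trans (at-ρ^ U t (x + n′)) (cong (at U) (+-assoc x n′ (t * n′))))

  at-periodic : ∀ (U : Subset n) x → at U (x + n) ≡ at U x
  at-periodic U x = at-≈ U (subst (λ y → x + y ≈ x) (*-identityˡ n) (+-periodic x 1))

  arcCount≡∑ : ∀ (U : Subset n) i m → arcCount U i m ≡ ∑ m (λ j → bit (at U (i + j)))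
  arcCount≡∑ U i zero    = refl
  arcCount≡∑ U i (suc m) = trans (+-comm _ (arcCount U i m)) (cong (_+ bit (at U (i + m))) (arcCount≡∑ U i m))

  ∣∣≡∑at : ∀ (U : Subset n) → ∣ U ∣ ≡ ∑ n (λ x → bit (at U x))
  ∣∣≡∑at U = ∣∣≡∑ U (λ x → bit (at U x)) (λ i → cong bit (at-toℕ U i))

  ∑-rotate-at : ∀ (U : Subset n) i → ∑ n (λ j → bit (at U (i + j))) ≡ ∣ U ∣
  ∑-rotate-at U i = trans (∑-periodic n (λ x → bit (at U x)) (λ x → cong bit (at-periodic U x)) i) (sym (∣∣≡∑at U))

  arcCount-full : ∀ (U : Subset n) i → arcCount U i n ≡ ∣ U ∣
  arcCount-full U i = trans (arcCount≡∑ U i n) (∑-rotate-at U i)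

  ∑-arcCount : ∀ (U : Subset n) m → ∑ n (λ i → arcCount U i m) ≡ m * ∣ U ∣
  ∑-arcCount U m = begin
    ∑ n (λ i → arcCount U i m)                        ≡⟨ ∑-cong n (λ i _ → arcCount≡∑ U i m) ⟩
    ∑ n (λ i → ∑ m (λ j → bit (at U (i + j))))        ≡⟨ ∑-comm m n (λ i j → bit (at U (i + j))) ⟩
    ∑ m (λ j → ∑ n (λ i → bit (at U (i + j))))        ≡⟨ ∑-cong m (λ j _ → column j) ⟩
    ∑ m (λ _ → ∣ U ∣)                                 ≡⟨ ∑-const m ∣ U ∣ ⟩
    m * ∣ U ∣                                         ∎
    where
    open ≡-Reasoning
    column : ∀ j → ∑ n (λ i → bit (at U (i + j))) ≡ ∣ U ∣
    column j = trans (∑-cong n (λ i _ → cong (bit ∘ at U) (+-comm i j))) (∑-rotate-at U j)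

  arcCount-+ : ∀ (U : Subset n) i a b → arcCount U i (a + b) ≡ arcCount U i a + arcCount U (i + a) b
  arcCount-+ U i a zero    = trans (cong (arcCount U i) (+-identityʳ a)) (sym (+-identityʳ _))
  arcCount-+ U i a (suc b) = begin
    arcCount U i (a + suc b)
      ≡⟨ cong (arcCount U i) (+-suc a b) ⟩
    bit (at U (i + (a + b))) + arcCount U i (a + b)
      ≡⟨ cong₂ (λ x y → bit (at U x) + y) (sym (+-assoc i a b)) (arcCount-+ U i a b) ⟩
    bit (at U (i + a + b)) + (arcCount U i a + arcCount U (i + a) b)
      ≡⟨ +-CS.x∙yz≈y∙xz (bit (at U (i + a + b))) (arcCount U i a) (arcCount U (i + a) b) ⟩
    arcCount U i a + (bit (at U (i + a + b)) + arcCount U (i + a) b)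
      ∎
    where open ≡-Reasoning

  arcCount-≈ : ∀ (U : Subset n) {i j} m → i ≈ j → arcCount U i m ≡ arcCount U j m
  arcCount-≈ U zero    i≈j = refl
  arcCount-≈ U (suc m) i≈j = cong₂ _+_ (cong bit (at-≈ U (+-≈ i≈j (≈-refl {m})))) (arcCount-≈ U m i≈j)

  -- The n arcs of length m hold m·k points in total and their counts differ by at most one,
  -- so each count c satisfies |n·c − m·k| < n.
  module Balanced {k} {U : Subset n} (∣U∣≡k : ∣ U ∣ ≡ k) (ws : WellSpread U) where

    private
      c : ℕ → ℕ → ℕ
      c m i = arcCount U i m

      c-close : ∀ {m} i j → 1 ≤ m → m ≤ n′ → c m i ≤ c m j + 1
      c-close {m} i j 1≤m m≤n′ = subst₂ (λ x y → x ≤ y + 1)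
        (arcCount-≈ U m (toℕ-mod-≈ i)) (arcCount-≈ U m (toℕ-mod-≈ j))
        (proj₁ (ws (i mod n) (j mod n) m 1≤m m≤n′))

      ∑c : ∀ m → ∑ n (c m) ≡ m * k
      ∑c m = trans (∑-arcCount U m) (cong (m *_) ∣U∣≡k)

      c-full : ∀ i → c n i ≡ k
      c-full i = trans (arcCount-full U i) ∣U∣≡k

      c-mod : ∀ m i → c m (i % n) ≡ c m i
      c-mod m i = arcCount-≈ U m (%-≈ i)

      ∑[c+1] : ∀ m → ∑ n (λ j → c m j + 1) ≡ suc (m * k + n′)
      ∑[c+1] m = begin
        ∑ n (λ j → c m j + 1)            ≡⟨ ∑-distrib-+ n (c m) (λ _ → 1) ⟩
        ∑ n (c m) + ∑ n (λ _ → 1)        ≡⟨ cong₂ _+_ (∑c m) (trans (∑-const n 1) (*-identityʳ n)) ⟩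
        m * k + n                        ≡⟨ +-suc (m * k) n′ ⟩
        suc (m * k + n′)                 ∎
        where open ≡-Reasoning

    arcCount-lower : ∀ i m → m ≤ n → n * arcCount U i m ≤ m * k + n′
    arcCount-lower i zero    _     = subst (_≤ n′) (sym (*-zeroʳ n)) z≤n
    arcCount-lower i (suc m) 1+m≤n with m≤n⇒m<n∨m≡n 1+m≤n
    ... | inj₂ refl  = subst (λ x → n * x ≤ n * k + n′) (sym (c-full i)) (m≤m+n (n * k) n′)
    ... | inj₁ 1+m<n = s≤s⁻¹ (begin
      suc (n * c (suc m) i)              ≡⟨ cong suc (∑-const n (c (suc m) i)) ⟨
      suc (∑ n (λ _ → c (suc m) i))      ≤⟨ ∑-mono-< n (λ j _ → c-close i j (s≤s z≤n) (s≤s⁻¹ 1+m<n))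
                                              (m%n<n i n) (≤-reflexive (trans (cong suc (sym (c-mod (suc m) i))) (+-comm 1 _))) ⟩
      ∑ n (λ j → c (suc m) j + 1)        ≡⟨ ∑[c+1] (suc m) ⟩
      suc (suc m * k + n′)               ∎)
      where open ≤-Reasoning

    arcCount-upper : ∀ i m → m ≤ n → m * k ≤ n * arcCount U i m + n′
    arcCount-upper i zero    _     = z≤n
    arcCount-upper i (suc m) 1+m≤n with m≤n⇒m<n∨m≡n 1+m≤n
    ... | inj₂ refl  = subst (λ x → n * k ≤ n * x + n′) (sym (c-full i)) (m≤m+n (n * k) n′)
    ... | inj₁ 1+m<n = s≤s⁻¹ (begin
      suc (suc m * k)                    ≡⟨ cong suc (∑c (suc m)) ⟨
      suc (∑ n (c (suc m)))              ≤⟨ ∑-mono-< n (λ j _ → c-close j i (s≤s z≤n) (s≤s⁻¹ 1+m<n))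
                                              (m%n<n i n) (≤-reflexive (trans (+-comm 1 _) (cong (_+ 1) (c-mod (suc m) i)))) ⟩
      ∑ n (λ _ → c (suc m) i + 1)        ≡⟨ ∑-const n (c (suc m) i + 1) ⟩
      n * (c (suc m) i + 1)              ≡⟨ trans (*-distribˡ-+ n (c (suc m) i) 1) (cong (n * c (suc m) i +_) (*-identityʳ n)) ⟩
      n * c (suc m) i + n                ≡⟨ +-suc (n * c (suc m) i) n′ ⟩
      suc (n * c (suc m) i + n′)         ∎)
      where open ≤-Reasoning

-- Throughout, n = k + K with K = suc K′, so that n and K are successors by construction.
module Slope (k K′ : ℕ) where

  open Cyclic (k + K′) public

  n′ K : ℕ
  n′ = k + K′
  K = suc K′

  k+K≡n : k + K ≡ n
  k+K≡n = +-suc k K′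

  k<n : k < n
  k<n = s≤s (m≤m+n k K′)

  inWindow : ℕ → Bool
  inWindow y = y % n <ᵇ k

  inWindow-≈ : ∀ {y z} → y ≈ z → inWindow y ≡ inWindow z
  inWindow-≈ (mk≈ eq) = cong (_<ᵇ k) eq

  inWindow-true : ∀ y → y % n < k → inWindow y ≡ true
  inWindow-true y r<k = Equivalence.to T-≡ (<⇒<ᵇ r<k)

  inWindow⇒< : ∀ y → inWindow y ≡ true → y % n < k
  inWindow⇒< y eq = <ᵇ⇒< (y % n) k (Equivalence.from T-≡ eq)

  inWindow-false : ∀ y → k ≤ y % n → inWindow y ≡ false
  inWindow-false y k≤r = ¬-not (λ eq → ≤⇒≯ k≤r (inWindow⇒< y eq))

  record Mechanical (s c : ℕ) (U : Subset n) : Set where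
    constructor mkMechanical
    field membership : ∀ x → at U x ≡ inWindow (c + x * s)
  open Mechanical public

  mechanical-from-< : ∀ {s c U} → (∀ x → x < n → at U x ≡ inWindow (c + x * s)) → Mechanical s c U
  mechanical-from-< {s} {c} {U} member< = mkMechanical λ x → begin
    at U x                      ≡⟨ at-≈ U (%-≈ x) ⟨
    at U (x % n)                ≡⟨ member< (x % n) (m%n<n x n) ⟩
    inWindow (c + x % n * s)    ≡⟨ inWindow-≈ (+-≈ (≈-refl {c}) (*-≈ (%-≈ x) (≈-refl {s}))) ⟩
    inWindow (c + x * s)        ∎
    where open ≡-Reasoning

  mechanical-from-⇔ : ∀ {s c U} → (∀ x → x < n → (at U x ≡ true ⇔ (c + x * s) % n < k)) → Mechanical s c U
  mechanical-from-⇔ {s} {c} {U} member⇔ = mechanical-from-< λ x x<n → by-cases x x<n (at U x) refl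
    where
    by-cases : ∀ x → x < n → ∀ b → at U x ≡ b → at U x ≡ inWindow (c + x * s)
    by-cases x x<n true  x∈U = trans x∈U (sym (inWindow-true (c + x * s) (Equivalence.to (member⇔ x x<n) x∈U)))
    by-cases x x<n false x∉U = trans x∉U (sym (inWindow-false (c + x * s)
      (≮⇒≥ (λ r<k → contradiction (trans (sym x∉U) (Equivalence.from (member⇔ x x<n) r<k)) λ ()))))

  Mech : ℕ → ℕ → Subset n
  Mech s c = tabulate (λ i → inWindow (c + toℕ i * s))

  Mech-mechanical : ∀ s c → Mechanical s c (Mech s c)
  Mech-mechanical s c = mkMechanical λ x → trans (lookup∘tabulate (λ i → inWindow (c + toℕ i * s)) (x mod n))
    (inWindow-≈ (+-≈ (≈-refl {c}) (*-≈ (toℕ-mod-≈ x) (≈-refl {s}))))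

  mechanical-≈ : ∀ {s c c′ U} → c ≈ c′ → Mechanical s c U → Mechanical s c′ U
  mechanical-≈ c≈c′ mech = mkMechanical λ x → trans (membership mech x) (inWindow-≈ (+-≈ c≈c′ ≈-refl))

  mechanical-ext : ∀ {s c Y Z} → Mechanical s c Y → Mechanical s c Z → Y ≡ Z
  mechanical-ext mechY mechZ = at-ext (λ x → trans (membership mechY x) (sym (membership mechZ x)))

  private
    [r+qn]/n≡q : ∀ {r} q → r < n → (r + q * n) / n ≡ q
    [r+qn]/n≡q {r} q r<n = trans (+-distrib-/-∣ʳ r (divides-refl q)) (cong₂ _+_ (m<n⇒m/n≡0 r<n) (m*n/n≡m q n))

    /-split : ∀ y z → (y + z) / n ≡ (y % n + z) / n + y / n
    /-split y z = begin
      (y + z) / n                       ≡⟨ cong (λ w → (w + z) / n) (m≡m%n+[m/n]*n y n) ⟩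
      (y % n + y / n * n + z) / n       ≡⟨ cong (_/ n) (+-CS.xy∙z≈xz∙y (y % n) (y / n * n) z) ⟩
      (y % n + z + y / n * n) / n       ≡⟨ +-distrib-/-∣ʳ (y % n + z) (divides-refl (y / n)) ⟩
      (y % n + z) / n + y / n * n / n   ≡⟨ cong ((y % n + z) / n +_) (m*n/n≡m (y / n) n) ⟩
      (y % n + z) / n + y / n           ∎
      where open ≡-Reasoning

    carry : ∀ {r} → r < n → (r + k) / n ≡ bit (inWindow (r + k))
    carry {r} r<n with r + k <? n
    ... | yes r+k<n = trans (m<n⇒m/n≡0 r+k<n)
      (sym (cong bit (inWindow-false (r + k) (subst (k ≤_) (sym (m<n⇒m%n≡m r+k<n)) (m≤n+m k r)))))
    ... | no  r+k≮n = begin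
      (r + k) / n                ≡⟨ cong (_/ n) r+k≡d+n ⟩
      (d + 1 * n) / n            ≡⟨ [r+qn]/n≡q 1 d<n ⟩
      1                          ≡⟨ cong bit (inWindow-true (r + k) (subst (_< k) (sym [r+k]%n≡d) d<k)) ⟨
      bit (inWindow (r + k))     ∎
      where
      open ≡-Reasoning
      n≤r+k : n ≤ r + k
      n≤r+k = ≮⇒≥ r+k≮n
      d : ℕ
      d = r + k ∸ n
      r+k≡d+n : r + k ≡ d + 1 * n
      r+k≡d+n = trans (sym (m∸n+n≡m n≤r+k)) (cong (d +_) (sym (*-identityˡ n)))
      d<k : d < k
      d<k = +-cancelʳ-< n d k (subst₂ _<_ (sym (m∸n+n≡m n≤r+k)) (+-comm n k) (+-monoˡ-< k r<n))
      d<n : d < n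
      d<n = <-trans d<k k<n
      [r+k]%n≡d : (r + k) % n ≡ d
      [r+k]%n≡d = trans (cong (_% n) r+k≡d+n) (trans (+-periodic d 1 .%≡%) (m<n⇒m%n≡m d<n))

    /-step : ∀ y → (y + k) / n ≡ y / n + bit (inWindow (y + k))
    /-step y = begin
      (y + k) / n                            ≡⟨ /-split y k ⟩
      (y % n + k) / n + y / n                ≡⟨ cong (_+ y / n) (carry (m%n<n y n)) ⟩
      bit (inWindow (y % n + k)) + y / n     ≡⟨ cong (λ b → bit b + y / n) (inWindow-≈ (+-≈ (%-≈ y) (≈-refl {k}))) ⟩
      bit (inWindow (y + k)) + y / n         ≡⟨ +-comm _ (y / n) ⟩
      y / n + bit (inWindow (y + k))         ∎
      where open ≡-Reasoning

  module _ {e} {T : Subset n} (mech : Mechanical k e T) where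

    private
      y : ℕ → ℕ
      y i = e + i * k + K

      member-shift : ∀ i m → e + (i + m) * k ≈ y i + m * k + k
      member-shift i m = ≈-sym (≈-trans (≈-reflexive (shuffle e i m k K′)) (+-periodic (e + (i + m) * k) 1))
        where
        shuffle : ∀ e i m k K′ → e + i * k + suc K′ + m * k + k ≡ e + (i + m) * k + 1 * suc (k + K′)
        shuffle = solve-∀

      -- i + m ∈ T exactly when y i + m·k + k passes a multiple of n, so the count telescopes
      arcCount-floor : ∀ i m → arcCount T i m + y i / n ≡ (y i + m * k) / n
      arcCount-floor i zero    = cong (_/ n) (sym (+-identityʳ (y i)))
      arcCount-floor i (suc m) = begin
        bit (at T (i + m)) + arcCount T i m + y i / n        ≡⟨ +-assoc (bit (at T (i + m))) _ _ ⟩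
        bit (at T (i + m)) + (arcCount T i m + y i / n)      ≡⟨ cong (bit (at T (i + m)) +_) (arcCount-floor i m) ⟩
        bit (at T (i + m)) + (y i + m * k) / n               ≡⟨ +-comm _ ((y i + m * k) / n) ⟩
        (y i + m * k) / n + bit (at T (i + m))               ≡⟨ cong (λ b → (y i + m * k) / n + bit b) i+m∈T ⟩
        (y i + m * k) / n + bit (inWindow (y i + m * k + k)) ≡⟨ /-step (y i + m * k) ⟨
        (y i + m * k + k) / n                                ≡⟨ cong (_/ n) (+-assoc (y i) (m * k) k) ⟩
        (y i + (m * k + k)) / n                              ≡⟨ cong (λ z → (y i + z) / n) (+-comm (m * k) k) ⟩
        (y i + suc m * k) / n                                ∎
        where
        open ≡-Reasoning
        i+m∈T : at T (i + m) ≡ inWindow (y i + m * k + k)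
        i+m∈T = trans (membership mech (i + m)) (inWindow-≈ (member-shift i m))

    arcCount-mechanical : ∀ i m → arcCount T i m ≡ (y i % n + m * k) / n
    arcCount-mechanical i m = +-cancelʳ-≡ (y i / n) _ _ (trans (arcCount-floor i m) (/-split (y i) (m * k)))

    ∣∣-mechanical : ∣ T ∣ ≡ k
    ∣∣-mechanical = begin
      ∣ T ∣                          ≡⟨ arcCount-full T 0 ⟨
      arcCount T 0 n                 ≡⟨ arcCount-mechanical 0 n ⟩
      (y 0 % n + n * k) / n          ≡⟨ cong (λ z → (y 0 % n + z) / n) (*-comm n k) ⟩
      (y 0 % n + k * n) / n          ≡⟨ [r+qn]/n≡q k (m%n<n (y 0) n) ⟩
      k                              ∎
      where open ≡-Reasoning

    private
      arcCount-bounds : ∀ i m → m * k / n ≤ arcCount T i m × arcCount T i m ≤ m * k / n + 1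
      arcCount-bounds i m rewrite arcCount-mechanical i m =
        /-monoˡ-≤ n (m≤n+m (m * k) (y i % n)) ,
        (begin
          (y i % n + m * k) / n      ≤⟨ /-monoˡ-≤ n (+-monoˡ-≤ (m * k) (<⇒≤ (m%n<n (y i) n))) ⟩
          (n + m * k) / n            ≡⟨ +-distrib-/-∣ˡ (m * k) ∣-refl ⟩
          n / n + m * k / n          ≡⟨ cong (_+ m * k / n) (n/n≡1 n) ⟩
          1 + m * k / n              ≡⟨ +-comm 1 (m * k / n) ⟩
          m * k / n + 1              ∎)
        where open ≤-Reasoning

    mechanical⇒WellSpread : WellSpread T
    mechanical⇒WellSpread i j m _ _ = close (toℕ i) (toℕ j) , close (toℕ j) (toℕ i)
      where
      close : ∀ i j → arcCount T i m ≤ arcCount T j m + 1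
      close i j = ≤-trans (proj₂ (arcCount-bounds i m)) (+-monoˡ-≤ 1 (proj₁ (arcCount-bounds j m)))

    mechanical⇒separated : k ≤ K → ∀ x → ¬ (at T x ≡ true × at T (x + 1) ≡ true)
    mechanical⇒separated k≤K x (x∈T , x+1∈T) = <⇒≱ r′<k k≤r′
      where
      r′<k : (e + (x + 1) * k) % n < k
      r′<k = inWindow⇒< (e + (x + 1) * k) (trans (sym (membership mech (x + 1))) x+1∈T)
      r : ℕ
      r = (e + x * k) % n
      r<k : r < k
      r<k = inWindow⇒< (e + x * k) (trans (sym (membership mech x)) x∈T)
      r+k<n : r + k < n
      r+k<n = subst (r + k <_) k+K≡n (+-mono-<-≤ r<k k≤K)
      r+k≈ : e + (x + 1) * k ≈ r + k
      r+k≈ = ≈-trans (≈-reflexive (shuffle e x k)) (+-≈ (≈-sym (%-≈ (e + x * k))) (≈-refl {k}))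
        where
        shuffle : ∀ e x k → e + (x + 1) * k ≡ e + x * k + k
        shuffle = solve-∀
      k≤r′ : k ≤ (e + (x + 1) * k) % n
      k≤r′ = subst (k ≤_) (sym (trans (r+k≈ .%≡%) (m<n⇒m%n≡m r+k<n))) (m≤n+m k r)

    mechanical⇒QVertex : k ≤ K → QVertex n k T
    mechanical⇒QVertex k≤K = (∣∣-mechanical , λ i → mechanical⇒separated k≤K (toℕ i)) , mechanical⇒WellSpread

  mechanical-ρ^ : ∀ {c U} t → Mechanical K c U → Mechanical K (c + t * k) (ρ^ t U)
  mechanical-ρ^ {c} {U} t mech = mkMechanical λ x → begin
    at (ρ^ t U) x                       ≡⟨ at-ρ^ U t x ⟩
    at U (x + t * n′)                   ≡⟨ membership mech (x + t * n′) ⟩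
    inWindow (c + (x + t * n′) * K)     ≡⟨ inWindow-≈ (≈-trans (≈-reflexive (shuffle c x t k K′)) (+-periodic _ (t * K′))) ⟩
    inWindow (c + t * k + x * K)        ∎
    where
    open ≡-Reasoning
    shuffle : ∀ c x t k K′ → c + (x + t * (k + K′)) * suc K′ ≡ c + t * k + x * suc K′ + t * K′ * suc (k + K′)
    shuffle = solve-∀

  Near : ℕ → ℕ → Set
  Near a b = b ⊖ a < k ⊎ a ⊖ b < k

  mechanical-meet : ∀ {s a b X Y} → Mechanical s a X → Mechanical s b Y → ¬ Disjoint X Y → Near a b
  mechanical-meet {s} {a} {b} {X} {Y} mechX mechY X∩Y≢∅ with b ⊖ a <? k | a ⊖ b <? k
  ... | yes near | _        = inj₁ near
  ... | no  _    | yes near = inj₂ near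
  ... | no  far  | no  far′ = contradiction disjoint X∩Y≢∅
    where
    gap : ∀ a b x → (a + x * s) % n ≤ (b + x * s) % n → (b + x * s) % n < k → b ⊖ a < k
    gap a b x p≤q q<k = ≤-<-trans (begin
      b ⊖ a                                   ≡⟨ ⊖-+ a b (x * s) ⟨
      (b + x * s) ⊖ (a + x * s)               ≡⟨ ⊖-cong (≈-sym (%-≈ (a + x * s))) (≈-sym (%-≈ (b + x * s))) ⟩
      (b + x * s) % n ⊖ (a + x * s) % n       ≡⟨ ⊖-≤ p≤q (m%n<n (b + x * s) n) ⟩
      (b + x * s) % n ∸ (a + x * s) % n       ≤⟨ m∸n≤m ((b + x * s) % n) ((a + x * s) % n) ⟩
      (b + x * s) % n                         ∎) q<k
      where open ≤-Reasoning
    disjoint : Disjoint X Y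
    disjoint i (x∈X , x∈Y) with ≤-total ((a + toℕ i * s) % n) ((b + toℕ i * s) % n)
    ... | inj₁ p≤q = far (gap a b (toℕ i) p≤q (inWindow⇒< (b + toℕ i * s) (trans (sym (membership mechY (toℕ i))) x∈Y)))
    ... | inj₂ q≤p = far′ (gap b a (toℕ i) q≤p (inWindow⇒< (a + toℕ i * s) (trans (sym (membership mechX (toℕ i))) x∈X)))

  -- at x with a + x s ≡ 0 (mod n), x ∈ U forces b + x s ≡ b ⊖ a into the window
  mechanical-⊖< : ∀ {s a b U} → Coprime n s → 1 ≤ k → Mechanical s a U → Mechanical s b U → b ⊖ a < k
  mechanical-⊖< {s} {a} {b} cop 1≤k mechA mechB with x , xs≈0⊖a ← unit-surjective cop (0 ⊖ a) =
    subst (_< k) [b+xs]%n≡b⊖a (inWindow⇒< (b + x * s) (trans (sym (membership mechB x)) (trans (membership mechA x) x∈U)))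
    where
    x∈U : inWindow (a + x * s) ≡ true
    x∈U = inWindow-true (a + x * s) (subst (_< k) (sym (≈-trans (+-≈ (≈-refl {a}) xs≈0⊖a) (+⊖ a 0) .%≡%)) 1≤k)
    [b+xs]%n≡b⊖a : (b + x * s) % n ≡ b ⊖ a
    [b+xs]%n≡b⊖a = trans (≈-trans (+-≈ (≈-refl {b}) xs≈0⊖a) (+-0⊖ a b) .%≡%) (m<n⇒m%n≡m (⊖<n b a))

  mechanical-unique : ∀ {s a b U} → Coprime n s → 1 ≤ k → k ≤ K → Mechanical s a U → Mechanical s b U → a ≈ b
  mechanical-unique {s} {a} {b} cop 1≤k k≤K mechA mechB with a % n ≟ b % n
  ... | yes eq  = mk≈ eq
  ... | no  a≉b = contradiction (⊖+⊖ (a≉b ∘ _≈_.%≡%)) (<⇒≢ (begin-strict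
    (b ⊖ a) + (a ⊖ b) <⟨ +-mono-< (mechanical-⊖< cop 1≤k mechA mechB) (mechanical-⊖< cop 1≤k mechB mechA) ⟩
    k + k             ≤⟨ +-monoʳ-≤ k k≤K ⟩
    k + K             ≡⟨ k+K≡n ⟩
    n                 ∎))
    where open ≤-Reasoning

  inWindow-reflect : 1 ≤ k → ∀ y → inWindow y ≡ inWindow (pred k ⊖ y)
  inWindow-reflect 1≤k y =
    trans (sym (inWindow-≈ (%-≈ y))) (trans (reflect (y % n) (m%n<n y n)) (cong inWindow (⊖-cong (%-≈ y) ≈-refl)))
    where
    pred[k]<k : pred k < k
    pred[k]<k = ≤-reflexive (suc-pred k {{>-nonZero 1≤k}})
    reflect : ∀ r → r < n → inWindow r ≡ inWindow (pred k ⊖ r)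
    reflect r r<n with r <? k
    ... | yes r<k = trans (inWindow-true r (subst (_< k) (sym (m<n⇒m%n≡m r<n)) r<k))
      (sym (inWindow-true (pred k ⊖ r) (subst (_< k) (sym (m<n⇒m%n≡m (⊖<n (pred k) r))) (begin-strict
        pred k ⊖ r     ≡⟨ ⊖-≤ (<⇒≤pred r<k) (<-trans pred[k]<k k<n) ⟩
        pred k ∸ r     ≤⟨ m∸n≤m (pred k) r ⟩
        pred k         <⟨ pred[k]<k ⟩
        k              ∎))))
      where open ≤-Reasoning
    ... | no  r≮k = trans (inWindow-false r (subst (k ≤_) (sym (m<n⇒m%n≡m r<n)) k≤r))
      (sym (inWindow-false (pred k ⊖ r) (subst (k ≤_) (sym (m<n⇒m%n≡m (⊖<n (pred k) r))) k≤pk⊖r)))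
      where
      k≤r : k ≤ r
      k≤r = ≮⇒≥ r≮k
      pk≤r : pred k ≤ r
      pk≤r = <⇒≤ (<-≤-trans pred[k]<k k≤r)
      pk≉r : pred k ≉ r
      pk≉r pk≈r = <⇒≢ (<-≤-trans pred[k]<k k≤r) (≈⇒≡ (<-trans pred[k]<k k<n) r<n pk≈r)
      r∸pk≤K : r ∸ pred k ≤ K
      r∸pk≤K = m≤n+o⇒m∸n≤o r (pred k) (subst (r ≤_) (sym pk+K≡n′) (s≤s⁻¹ r<n))
        where
        pk+K≡n′ : pred k + K ≡ n′
        pk+K≡n′ = trans (+-suc (pred k) K′) (cong (_+ K′) (suc-pred k {{>-nonZero 1≤k}}))
      k≤pk⊖r : k ≤ pred k ⊖ r
      k≤pk⊖r = +-cancelʳ-≤ K k (pred k ⊖ r) (begin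
        k + K                        ≡⟨ k+K≡n ⟩
        n                            ≡⟨ ⊖+⊖ pk≉r ⟨
        (r ⊖ pred k) + (pred k ⊖ r)  ≡⟨ cong (_+ (pred k ⊖ r)) (⊖-≤ pk≤r r<n) ⟩
        (r ∸ pred k) + (pred k ⊖ r)  ≤⟨ +-monoˡ-≤ (pred k ⊖ r) r∸pk≤K ⟩
        K + (pred k ⊖ r)             ≡⟨ +-comm K (pred k ⊖ r) ⟩
        (pred k ⊖ r) + K             ∎)
        where open ≤-Reasoning

  mechanical-reflect : ∀ {c U} → 1 ≤ k → Mechanical K c U → Mechanical k (pred k ⊖ c) U
  mechanical-reflect {c} 1≤k mech = mkMechanical λ x →
    trans (membership mech x) (trans (inWindow-reflect 1≤k (c + x * K)) (inWindow-≈ (negate x)))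
    where
    negate : ∀ x → pred k ⊖ (c + x * K) ≈ (pred k ⊖ c) + x * k
    negate x = +-cancelˡ-≈ (c + x * K) (begin
      c + x * K + (pred k ⊖ (c + x * K))    ≈⟨ +⊖ (c + x * K) (pred k) ⟩
      pred k                                ≈⟨ +⊖ c (pred k) ⟨
      c + (pred k ⊖ c)                      ≈⟨ +-periodic (c + (pred k ⊖ c)) x ⟨
      c + (pred k ⊖ c) + x * n              ≡⟨ shuffle c (pred k ⊖ c) x k K′ ⟨
      c + x * K + ((pred k ⊖ c) + x * k)    ∎)
      where
      open ≈-Reasoning
      shuffle : ∀ c d x k K′ → c + x * suc K′ + (d + x * k) ≡ c + d + x * suc (k + K′)
      shuffle = solve-∀

  -- The potential g x = n·|U ∩ [0, x)| + (n − x)·k steps by n·[x ∈ U] − k and, U being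
  -- well-spread, varies by less than n on [0, n].  With L = min g this gives x ∈ U iff
  -- g x − L < k, while g x − L ≡ L·n′ + x·K (mod n).
  module _ {U : Subset n} (∣U∣≡k : ∣ U ∣ ≡ k) (ws : WellSpread U) where

    open Balanced ∣U∣≡k ws

    private
      N : ℕ → ℕ
      N x = arcCount U 0 x

      g : ℕ → ℕ
      g x = n * N x + (n ∸ x) * k

      g-window : ∀ {x y} → x ≤ y → y ≤ n → g y ≤ g x + n′ × g x ≤ g y + n′
      g-window {x} {y} x≤y y≤n =
        subst₂ (λ u v → u ≤ v + n′) (sym gy≡) (sym gx≡)
          (≤-trans (+-monoʳ-≤ A (arcCount-lower x m m≤n)) (≤-reflexive (sym (+-assoc A (m * k) n′)))) ,
        subst₂ (λ u v → u ≤ v + n′) (sym gx≡) (sym gy≡)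
          (≤-trans (+-monoʳ-≤ A (arcCount-upper x m m≤n)) (≤-reflexive (sym (+-assoc A (n * c) n′))))
        where
        m r c A : ℕ
        m = y ∸ x
        r = n ∸ y
        c = arcCount U x m
        A = n * N x + r * k
        m≤n : m ≤ n
        m≤n = ≤-trans (m∸n≤m y x) y≤n
        y≡x+m : y ≡ x + m
        y≡x+m = sym (m+[n∸m]≡n x≤y)
        n∸x≡m+r : n ∸ x ≡ m + r
        n∸x≡m+r = begin
          n ∸ x               ≡⟨ cong (_∸ x) (m+[n∸m]≡n y≤n) ⟨
          y + r ∸ x           ≡⟨ cong (λ z → z + r ∸ x) y≡x+m ⟩
          x + m + r ∸ x       ≡⟨ cong (_∸ x) (+-assoc x m r) ⟩
          x + (m + r) ∸ x     ≡⟨ m+n∸m≡n x (m + r) ⟩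
          m + r               ∎
          where open ≡-Reasoning
        gy≡ : g y ≡ A + n * c
        gy≡ = trans (cong (λ z → n * arcCount U 0 z + r * k) y≡x+m)
          (trans (cong (λ z → n * z + r * k) (arcCount-+ U 0 x m)) (shuffle n (N x) c r k))
          where
          shuffle : ∀ n a c r k → n * (a + c) + r * k ≡ n * a + r * k + n * c
          shuffle = solve-∀
        gx≡ : g x ≡ A + m * k
        gx≡ = trans (cong (λ z → n * N x + z * k) n∸x≡m+r) (shuffle (n * N x) m r k)
          where
          shuffle : ∀ a m r k → a + (m + r) * k ≡ a + r * k + m * k
          shuffle = solve-∀

      opaque
        xₘᵢₙ : ℕ
        xₘᵢₙ = argmin g 0 (upTo (suc n))

        xₘᵢₙ≤n : xₘᵢₙ ≤ n
        xₘᵢₙ≤n = argmin-all g {0} {upTo (suc n)} {P = _≤ n} z≤n (All.tabulate (λ x∈ → s≤s⁻¹ (∈-upTo⁻ x∈)))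

        g[xₘᵢₙ]≤g : ∀ {x} → x ≤ n → g xₘᵢₙ ≤ g x
        g[xₘᵢₙ]≤g x≤n = All.lookup (f[argmin]≤f[xs] {f = g} 0 (upTo (suc n))) (∈-upTo⁺ (s≤s x≤n))

      L : ℕ
      L = g xₘᵢₙ

      g≤L+n′ : ∀ {x} → x ≤ n → g x ≤ L + n′
      g≤L+n′ {x} x≤n with ≤-total x xₘᵢₙ
      ... | inj₁ x≤xₘᵢₙ = proj₂ (g-window x≤xₘᵢₙ xₘᵢₙ≤n)
      ... | inj₂ xₘᵢₙ≤x = proj₁ (g-window xₘᵢₙ≤x x≤n)

      g-step : ∀ {x} → x < n → g (suc x) + k ≡ g x + bit (at U x) * n
      g-step {x} x<n = trans (shuffle n (bit (at U x)) (N x) (n′ ∸ x) k)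
        (cong (λ z → n * N x + z * k + bit (at U x) * n) (sym (+-∸-assoc 1 (s≤s⁻¹ x<n))))
        where
        shuffle : ∀ n b a d k → n * (b + a) + d * k + k ≡ n * a + suc d * k + b * n
        shuffle = solve-∀

      D : ℕ → ℕ
      D x = g x ∸ L

      D%n≡D : ∀ {x} → x ≤ n → D x % n ≡ D x
      D%n≡D {x} x≤n = m<n⇒m%n≡m (s≤s (m≤n+o⇒m∸n≤o (g x) L (g≤L+n′ x≤n)))

      member : ∀ {x} → x < n → at U x ≡ inWindow (D x)
      member {x} x<n = by-cases (at U x) refl
        where
        step : ∀ {b} → at U x ≡ b → g (suc x) + k ≡ g x + bit b * n
        step x∈U? = subst (λ b → g (suc x) + k ≡ g x + bit b * n) x∈U? (g-step x<n)
        by-cases : ∀ b → at U x ≡ b → at U x ≡ inWindow (D x)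
        by-cases true  x∈U = trans x∈U (sym (inWindow-true (D x) (subst (_< k) (sym (D%n≡D (<⇒≤ x<n))) Dx<k)))
          where
          1+g+n′≤ : suc (g x) + n′ ≤ L + k + n′
          1+g+n′≤ = begin
            suc (g x) + n′       ≡⟨ +-suc (g x) n′ ⟨
            g x + suc n′         ≡⟨ cong (g x +_) (*-identityˡ n) ⟨
            g x + 1 * n          ≡⟨ step x∈U ⟨
            g (suc x) + k        ≤⟨ +-monoˡ-≤ k (g≤L+n′ x<n) ⟩
            L + n′ + k           ≡⟨ +-CS.xy∙z≈xz∙y L n′ k ⟩
            L + k + n′           ∎
            where open ≤-Reasoning
          Dx<k : D x < k
          Dx<k = subst (_≤ k) (+-∸-assoc 1 (g[xₘᵢₙ]≤g (<⇒≤ x<n)))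
            (m≤n+o⇒m∸n≤o (suc (g x)) L (+-cancelʳ-≤ n′ (suc (g x)) (L + k) 1+g+n′≤))
        by-cases false x∉U = trans x∉U (sym (inWindow-false (D x) (subst (k ≤_) (sym (D%n≡D (<⇒≤ x<n))) k≤Dx)))
          where
          k+L≤g : k + L ≤ g x
          k+L≤g = begin
            k + L                ≡⟨ +-comm k L ⟩
            L + k                ≤⟨ +-monoˡ-≤ k (g[xₘᵢₙ]≤g x<n) ⟩
            g (suc x) + k        ≡⟨ step x∉U ⟩
            g x + 0              ≡⟨ +-identityʳ (g x) ⟩
            g x                  ∎
            where open ≤-Reasoning
          k≤Dx : k ≤ D x
          k≤Dx = m+n≤o⇒m≤o∸n k k+L≤g

      D≈ : ∀ {x} → x ≤ n → D x ≈ L * n′ + x * K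
      D≈ {x} x≤n = +-cancelˡ-≈ (x * k) (begin
        x * k + D x                              ≈⟨ +-periodic (x * k + D x) L ⟨
        x * k + D x + L * n                      ≡⟨ shuffle₁ (x * k) (D x) L n′ ⟩
        D x + L + x * k + L * n′                 ≡⟨ cong (λ z → z + x * k + L * n′) (m∸n+n≡m (g[xₘᵢₙ]≤g x≤n)) ⟩
        n * N x + (n ∸ x) * k + x * k + L * n′   ≡⟨ cong (_+ L * n′) (+-assoc (n * N x) ((n ∸ x) * k) (x * k)) ⟩
        n * N x + ((n ∸ x) * k + x * k) + L * n′ ≡⟨ cong (λ z → n * N x + z + L * n′) [n∸x]k+xk≡nk ⟩
        n * N x + n * k + L * n′                 ≡⟨ shuffle₂ n (N x) k (L * n′) ⟩
        L * n′ + (N x + k) * n                   ≈⟨ +-periodic (L * n′) (N x + k) ⟩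
        L * n′                                   ≈⟨ +-periodic (L * n′) x ⟨
        L * n′ + x * n                           ≡⟨ shuffle₃ (L * n′) x k K′ ⟩
        x * k + (L * n′ + x * K)                 ∎)
        where
        open ≈-Reasoning
        [n∸x]k+xk≡nk : (n ∸ x) * k + x * k ≡ n * k
        [n∸x]k+xk≡nk = trans (sym (*-distribʳ-+ k (n ∸ x) x)) (cong (_* k) (m∸n+n≡m x≤n))
        shuffle₁ : ∀ a d L n′ → a + d + L * suc n′ ≡ d + L + a + L * n′
        shuffle₁ = solve-∀
        shuffle₂ : ∀ n a k c → n * a + n * k + c ≡ c + (a + k) * n
        shuffle₂ = solve-∀
        shuffle₃ : ∀ c x k K′ → c + x * suc (k + K′) ≡ x * k + (c + x * suc K′)
        shuffle₃ = solve-∀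

    well-spread⇒mechanical : ∃[ c ] Mechanical K c U
    well-spread⇒mechanical = L * n′ , mechanical-from-< (λ x x<n → trans (member x<n) (inWindow-≈ (D≈ (<⇒≤ x<n))))

module Arcs (k K′ : ℕ) where

  open Slope k K′

  module _ (1≤k : 1 ≤ k) (k<K⊎k≡1 : k < K ⊎ k ≡ 1)
           {V : List ℕ} (uniq : Unique V) (V<n : All (_< n) V) (k≤∣V∣ : k ≤ length V)
           (near : ∀ {v w} → v ∈ V → w ∈ V → v ≢ w → Near v w) where

    private
      k≤K : k ≤ K
      k≤K = [ <⇒≤ , (λ k≡1 → subst (_≤ K) (sym k≡1) (s≤s z≤n)) ]′ k<K⊎k≡1

      K<n : K < n
      K<n = subst (K <_) (trans (+-comm K k) k+K≡n) (m<m+n K 1≤k)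

    -- going the other way round, the distance is n − Δ ≥ k as well
    gap : ∀ {v w Δ} → v ∈ V → w ∈ V → v + Δ ≈ w → k ≤ Δ → Δ ≤ K → ⊥
    gap {v} {w} {Δ} v∈V w∈V v+Δ≈w k≤Δ Δ≤K =
      [ (λ w⊖v<k → <⇒≱ w⊖v<k (subst (k ≤_) (sym w⊖v≡Δ) k≤Δ)) , (λ v⊖w<k → <⇒≱ v⊖w<k k≤v⊖w) ]′
      (near v∈V w∈V (v≉w ∘ ≈-reflexive))
      where
      w⊖v≡Δ : w ⊖ v ≡ Δ
      w⊖v≡Δ = ⊖-unique (≤-<-trans Δ≤K K<n) v+Δ≈w
      v≉w : v ≉ w
      v≉w v≈w = contradiction (≤-trans 1≤k (subst (k ≤_) Δ≡0 k≤Δ)) λ ()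
        where
        Δ≡0 : Δ ≡ 0
        Δ≡0 = trans (sym w⊖v≡Δ) (trans (⊖-cong v≈w ≈-refl) (⊖-self w))
      k≤v⊖w : k ≤ v ⊖ w
      k≤v⊖w = +-cancelʳ-≤ K k (v ⊖ w) (begin
        k + K              ≡⟨ k+K≡n ⟩
        n                  ≡⟨ ⊖+⊖ v≉w ⟨
        (w ⊖ v) + (v ⊖ w)  ≡⟨ cong (_+ (v ⊖ w)) w⊖v≡Δ ⟩
        Δ + (v ⊖ w)        ≤⟨ +-monoˡ-≤ (v ⊖ w) Δ≤K ⟩
        K + (v ⊖ w)        ≡⟨ +-comm K (v ⊖ w) ⟩
        (v ⊖ w) + K        ∎)
        where open ≤-Reasoning

    private
      nonempty : ∀ {xs : List ℕ} → 1 ≤ length xs → ∃[ x ] x ∈ xs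
      nonempty {x ∷ _} _ = x , here refl

    v₀ : ℕ
    v₀ = proj₁ (nonempty {V} (≤-trans 1≤k k≤∣V∣))

    v₀∈V : v₀ ∈ V
    v₀∈V = proj₂ (nonempty {V} (≤-trans 1≤k k≤∣V∣))

    d : ℕ → ℕ
    d v = v ⊖ v₀

    v₀+d : ∀ v → v₀ + d v ≈ v
    v₀+d v = +⊖ v₀ v

    d-injective : ∀ {v w} → v < n → w < n → d v ≡ d w → v ≡ w
    d-injective {v} {w} v<n w<n dv≡dw =
      ≈⇒≡ v<n w<n (≈-trans (≈-sym (v₀+d v)) (≈-trans (≈-reflexive (cong (v₀ +_) dv≡dw)) (v₀+d w)))

    gap-d : ∀ {v w Δ} → v ∈ V → w ∈ V → d v + Δ ≈ d w → k ≤ Δ → Δ ≤ K → ⊥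
    gap-d {v} {w} {Δ} v∈V w∈V dv+Δ≈dw = gap v∈V w∈V (begin
      v + Δ               ≈⟨ +-≈ (v₀+d v) (≈-refl {Δ}) ⟨
      v₀ + d v + Δ        ≡⟨ +-assoc v₀ (d v) Δ ⟩
      v₀ + (d v + Δ)      ≈⟨ +-≈ (≈-refl {v₀}) dv+Δ≈dw ⟩
      v₀ + d w            ≈⟨ v₀+d w ⟩
      w                   ∎)
      where open ≈-Reasoning

    classify : ∀ {v} → v ∈ V → d v < k ⊎ K < d v
    classify {v} v∈V with d v <? k
    ... | yes dv<k = inj₁ dv<k
    ... | no  dv≮k = inj₂ (≰⇒> (gap-d v₀∈V v∈V (≈-reflexive (cong (_+ d v) (⊖-self v₀))) (≮⇒≥ dv≮k)))

    -- Folding (K, n) onto (0, k) is injective on V because its two branches differ by the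
    -- forbidden distance K; as ∣V∣ ≥ k, counting makes fold ∘ d hit every i < k.
    fold : ℕ → ℕ
    fold x with K <? x
    ... | yes _ = x ∸ K
    ... | no  _ = x

    fold-small : ∀ {x} → x < k → fold x ≡ x
    fold-small {x} x<k with K <? x
    ... | yes K<x = contradiction (<-trans K<x x<k) (≤⇒≯ k≤K)
    ... | no  _   = refl

    fold-large : ∀ {x} → K < x → fold x + K ≡ x
    fold-large {x} K<x with K <? x
    ... | yes _   = m∸n+n≡m (<⇒≤ K<x)
    ... | no  K≮x = contradiction K<x K≮x

    fold<k : ∀ {v} → v ∈ V → fold (d v) < k
    fold<k {v} v∈V with classify v∈V
    ... | inj₁ dv<k = subst (_< k) (sym (fold-small dv<k)) dv<k
    ... | inj₂ K<dv = +-cancelʳ-< K (fold (d v)) k (subst₂ _<_ (sym (fold-large K<dv)) (sym k+K≡n) (⊖<n v v₀))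

    fold-injective : InjectiveOn (fold ∘ d) V
    fold-injective {v} {w} v∈V w∈V eq with classify v∈V | classify w∈V
    ... | inj₁ dv<k | inj₁ dw<k = d-injective (All.lookup V<n v∈V) (All.lookup V<n w∈V)
      (trans (sym (fold-small dv<k)) (trans eq (fold-small dw<k)))
    ... | inj₂ K<dv | inj₂ K<dw = d-injective (All.lookup V<n v∈V) (All.lookup V<n w∈V)
      (trans (sym (fold-large K<dv)) (trans (cong (_+ K) eq) (fold-large K<dw)))
    ... | inj₁ dv<k | inj₂ K<dw = ⊥-elim (gap-d v∈V w∈V (≈-reflexive
      (trans (cong (_+ K) (trans (sym (fold-small dv<k)) eq)) (fold-large K<dw))) k≤K ≤-refl)
    ... | inj₂ K<dv | inj₁ dw<k = ⊥-elim (gap-d w∈V v∈V (≈-reflexive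
      (trans (cong (_+ K) (trans (sym (fold-small dw<k)) (sym eq))) (fold-large K<dv))) k≤K ≤-refl)

    P Q : ℕ → Set
    P i = Any (λ v → d v ≡ i) V
    Q i = Any (λ v → d v ≡ i + K) V

    fold-surjective : ∀ {i} → i < k → Any (λ v → fold (d v) ≡ i) V
    fold-surjective {i} i<k with any? (λ v → fold (d v) ≟ i) V
    ... | yes found  = found
    ... | no  ¬found = contradiction k≤∣V∣ (<⇒≱ (subst (length V <_) (length-upTo k)
      (length-<-injection (fold ∘ d) uniq fold-injective (∈-upTo⁺ ∘ fold<k) (∈-upTo⁺ i<k) (λ v∈V → ¬found ∘ lose v∈V))))

    P⊎Q : ∀ {i} → i < k → P i ⊎ Q i
    P⊎Q {i} i<k with v , v∈V , fold≡i ← find (fold-surjective i<k) with classify v∈V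
    ... | inj₁ dv<k = inj₁ (lose v∈V (trans (sym (fold-small dv<k)) fold≡i))
    ... | inj₂ K<dv = inj₂ (lose v∈V (trans (sym (fold-large K<dv)) (cong (_+ K) fold≡i)))

    ¬P∧Q : ∀ {i} → P i → Q i → ⊥
    ¬P∧Q pi qi with v , v∈V , dv≡i ← find pi | w , w∈V , dw≡i+K ← find qi =
      gap-d v∈V w∈V (≈-reflexive (trans (cong (_+ K) dv≡i) (sym dw≡i+K))) k≤K ≤-refl

    ¬Q∧P : ∀ {i} → suc i < k → Q i → P (suc i) → ⊥
    ¬Q∧P {i} 1+i<k qi pi′ with w , w∈V , dw≡i+K ← find qi | v , v∈V , dv≡1+i ← find pi′ =
      gap-d w∈V v∈V dw+[k+1]≈dv (m≤m+n k 1) k+1≤K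
      where
      k+1≤K : k + 1 ≤ K
      k+1≤K = [ (λ k<K → subst (_≤ K) (+-comm 1 k) k<K)
              , (λ k≡1 → contradiction (subst (suc i <_) k≡1 1+i<k) λ { (s≤s ()) })
              ]′ k<K⊎k≡1
      dw+[k+1]≈dv : d w + (k + 1) ≈ d v
      dw+[k+1]≈dv = begin
        d w + (k + 1)        ≡⟨ cong (_+ (k + 1)) dw≡i+K ⟩
        i + K + (k + 1)      ≡⟨ shuffle i k K′ ⟩
        suc i + 1 * n        ≈⟨ +-periodic (suc i) 1 ⟩
        suc i                ≡⟨ dv≡1+i ⟨
        d v                  ∎
        where
        open ≈-Reasoning
        shuffle : ∀ i k K′ → i + suc K′ + (k + 1) ≡ suc i + 1 * suc (k + K′)
        shuffle = solve-∀

    Q-up : ∀ {i} j → Q i → i ≤ j → j < k → Q j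
    Q-up zero    qi z≤n   _     = qi
    Q-up (suc j) qi i≤1+j 1+j<k with m≤n⇒m<n∨m≡n i≤1+j
    ... | inj₂ refl  = qi
    ... | inj₁ i<1+j = [ (λ p → ⊥-elim (¬Q∧P 1+j<k qj p)) , id ]′ (P⊎Q 1+j<k)
      where
      qj : Q j
      qj = Q-up j qi (s≤s⁻¹ i<1+j) (<-trans (n<1+n j) 1+j<k)

    P-down : ∀ {i j} → i ≤ j → j < k → P j → P i
    P-down {i} {j} i≤j j<k pj = [ id , (λ qi → ⊥-elim (¬P∧Q pj (Q-up j qi i≤j j<k))) ]′ (P⊎Q (≤-<-trans i≤j j<k))

    -- d V = [0, j) ∪ [K + j, n): an arc of length k ending at j − 1
    module Segment (j : ℕ) (j≤k : j ≤ k) (below : ∀ {i} → i < j → P i) (above : ∀ {i} → j ≤ i → i < k → ¬ P i) where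

      s : ℕ
      s = k ∸ j

      j+s≡k : j + s ≡ k
      j+s≡k = m+[n∸m]≡n j≤k

      d-∈ : ∀ {v} → v < n → Any (λ w → d w ≡ d v) V → v ∈ V
      d-∈ {v} v<n found with w , w∈V , dw≡dv ← find found = subst (_∈ V) (d-injective (All.lookup V<n w∈V) v<n dw≡dv) w∈V

      ∈⇒ : ∀ {v} → v ∈ V → (d v + s) % n < k
      ∈⇒ {v} v∈V with classify v∈V
      ... | inj₁ dv<k = subst (_< k) (sym (m<n⇒m%n≡m (<-trans dv+s<k k<n))) dv+s<k
        where
        dv<j : d v < j
        dv<j = ≰⇒> (λ j≤dv → above j≤dv dv<k (lose v∈V refl))
        dv+s<k : d v + s < k
        dv+s<k = subst (d v + s <_) j+s≡k (+-monoˡ-< s dv<j)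
      ... | inj₂ K<dv = subst (_< k) (sym [dv+s]%n≡) (≤-<-trans (m∸n≤m i j) i<k)
        where
        i : ℕ
        i = d v ∸ K
        dv≡i+K : d v ≡ i + K
        dv≡i+K = sym (m∸n+n≡m (<⇒≤ K<dv))
        i<k : i < k
        i<k = +-cancelʳ-< K i k (subst₂ _<_ dv≡i+K (sym k+K≡n) (⊖<n v v₀))
        j≤i : j ≤ i
        j≤i = ≮⇒≥ (λ i<j → ¬P∧Q (below i<j) (lose v∈V dv≡i+K))
        [dv+s]%n≡ : (d v + s) % n ≡ i ∸ j
        [dv+s]%n≡ = trans (cong (_% n) (begin
          d v + s                     ≡⟨ cong (_+ s) (trans dv≡i+K (cong (_+ K) (sym (m∸n+n≡m j≤i)))) ⟩
          i ∸ j + j + K + s           ≡⟨ shuffle (i ∸ j) j K s ⟩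
          i ∸ j + (j + s + K)         ≡⟨ cong (λ z → i ∸ j + (z + K)) j+s≡k ⟩
          i ∸ j + (k + K)             ≡⟨ cong (i ∸ j +_) (trans k+K≡n (sym (*-identityˡ n))) ⟩
          i ∸ j + 1 * n               ∎))
          (trans (+-periodic (i ∸ j) 1 .%≡%) (m<n⇒m%n≡m (≤-<-trans (m∸n≤m i j) (<-trans i<k k<n))))
          where
          open ≡-Reasoning
          shuffle : ∀ a b c e → a + b + c + e ≡ a + (b + e + c)
          shuffle = solve-∀

      ⇒∈ : ∀ {v} → v < n → (d v + s) % n < k → v ∈ V
      ⇒∈ {v} v<n r<k with d v <? j
      ... | yes dv<j = d-∈ v<n (below dv<j)
      ... | no  dv≮j = d-∈ v<n (Any.map (λ dw≡i+K → trans dw≡i+K (sym dv≡i+K)) qi)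
        where
        j≤dv : j ≤ d v
        j≤dv = ≮⇒≥ dv≮j
        n≤dv+s : n ≤ d v + s
        n≤dv+s = ≮⇒≥ (λ dv+s<n → <⇒≱ r<k (subst (k ≤_) (sym (m<n⇒m%n≡m dv+s<n)) k≤dv+s))
          where
          k≤dv+s : k ≤ d v + s
          k≤dv+s = subst (_≤ d v + s) j+s≡k (+-monoˡ-≤ s j≤dv)
        K+j≤dv : K + j ≤ d v
        K+j≤dv = +-cancelʳ-≤ s (K + j) (d v) (subst (_≤ d v + s) K+j+s≡n n≤dv+s)
          where
          K+j+s≡n : n ≡ K + j + s
          K+j+s≡n = sym (trans (+-assoc K j s) (trans (cong (K +_) j+s≡k) (trans (+-comm K k) k+K≡n)))
        i : ℕ
        i = d v ∸ K
        dv≡i+K : d v ≡ i + K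
        dv≡i+K = sym (m∸n+n≡m (≤-trans (m≤m+n K j) K+j≤dv))
        j≤i : j ≤ i
        j≤i = m+n≤o⇒m≤o∸n j (subst (_≤ d v) (+-comm K j) K+j≤dv)
        i<k : i < k
        i<k = +-cancelʳ-< K i k (subst₂ _<_ dv≡i+K (sym k+K≡n) (⊖<n v v₀))
        qi : Q i
        qi = [ (λ pi → ⊥-elim (above j≤i i<k pi)) , id ]′ (P⊎Q i<k)

    near⇒arc : ∃[ f ] ∀ {v} → v < n → (v ∈ V ⇔ (v + f) % n < k)
    near⇒arc with j , j≤k , below , above ← initial-segment (λ i → any? (λ v → d v ≟ i) V) k P-down =
      (0 ⊖ v₀) + s ,
      λ v<n → mk⇔ (λ v∈V → subst (_< k) shift (∈⇒ v∈V)) (λ r<k → ⇒∈ v<n (subst (_< k) (sym shift) r<k))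
      where
      open Segment j j≤k below above
      shift : ∀ {v} → (d v + s) % n ≡ (v + ((0 ⊖ v₀) + s)) % n
      shift {v} = ≈-trans (+-≈ (≈-sym (+-0⊖ v₀ v)) (≈-refl {s})) (≈-reflexive (+-assoc v (0 ⊖ v₀) s)) .%≡%

module Correspondence (k K′ : ℕ) (cop : Coprime (suc (k + K′)) k) (1≤k : 1 ≤ k) (k≤K : k ≤ suc K′) where

  open Slope k K′
  open Arcs k K′

  private
    coprime-n-K : Coprime n K
    coprime-n-K {d} (d∣n , d∣K) = cop (d∣n , ∣m+n∣m⇒∣n (subst (d ∣_) (trans (sym k+K≡n) (+-comm k K)) d∣n) d∣K)

    k<K⊎k≡1 : k < K ⊎ k ≡ 1
    k<K⊎k≡1 with m≤n⇒m<n∨m≡n k≤K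
    ... | inj₁ k<K = inj₁ k<K
    ... | inj₂ k≡K = inj₂ (cop (subst (k ∣_) (trans (cong (k +_) k≡K) k+K≡n) (∣m∣n⇒∣m+n ∣-refl ∣-refl) , ∣-refl))

  open DecMembership (≡-dec {n = n} Bool._≟_) using (_∈?_)

  Mech-injective : ∀ {v w} → v < n → w < n → Mech K v ≡ Mech K w → v ≡ w
  Mech-injective {v} {w} v<n w<n eq = ≈⇒≡ v<n w<n
    (mechanical-unique coprime-n-K 1≤k k≤K (Mech-mechanical K v) (subst (Mechanical K w) (sym eq) (Mech-mechanical K w)))

  Mech-QVertex : ∀ v → QVertex n k (Mech K v)
  Mech-QVertex v = mechanical⇒QVertex (mechanical-reflect 1≤k (Mech-mechanical K v)) k≤K

  -- k vertices containing 0, so the maximum independent set has at least k elements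
  star : List (Subset n)
  star = applyUpTo (Mech K) k

  star-independent : IndepQ n k star
  star-independent =
    applyUpTo⁺₁ (Mech K) k (λ i<j j<k → <⇒≢ i<j ∘ Mech-injective (<-trans (<-trans i<j j<k) k<n) (<-trans j<k k<n)) ,
    (λ X∈star → let v , _ , X≡ = ∈-applyUpTo⁻ (Mech K) X∈star in subst (QVertex n k) (sym X≡) (Mech-QVertex v)) ,
    (λ X∈star Y∈star _ disjoint → disjoint fzero (0∈ X∈star , 0∈ Y∈star))
    where
    0∈ : ∀ {X} → X ∈ star → at X 0 ≡ true
    0∈ X∈star with v , v<k , refl ← ∈-applyUpTo⁻ (Mech K) X∈star =
      trans (membership (Mech-mechanical K v) 0)
        (inWindow-true (v + 0) (subst (_< k) (sym (trans (cong (_% n) (+-identityʳ v)) (m<n⇒m%n≡m (<-trans v<k k<n)))) v<k))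

  module _ {X₀ L T} (qX₀ : QVertex n k X₀) (maxL : MaxIndepQ n k L) (corr : Corresponds X₀ L T) where

    private
      uniqL : Unique L
      uniqL = proj₁ (proj₁ maxL)

      qvL : ∀ {X} → X ∈ L → QVertex n k X
      qvL = proj₁ (proj₂ (proj₁ maxL))

      meetL : ∀ {X Y} → X ∈ L → Y ∈ L → X ≢ Y → ¬ Disjoint X Y
      meetL = proj₂ (proj₂ (proj₁ maxL))

    V : List ℕ
    V = filter (λ v → Mech K v ∈? L) (upTo n)

    V<n : All (_< n) V
    V<n = All.tabulate (∈-upTo⁻ ∘ proj₁ ∘ ∈-filter⁻ (λ v → Mech K v ∈? L))

    ∈V⇔ : ∀ {v} → v < n → v ∈ V ⇔ Mech K v ∈ L
    ∈V⇔ v<n = mk⇔ (proj₂ ∘ ∈-filter⁻ (λ v → Mech K v ∈? L)) (∈-filter⁺ (λ v → Mech K v ∈? L) (∈-upTo⁺ v<n))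

    L⊆MechV : ∀ {Y} → Y ∈ L → Y ∈ map (Mech K) V
    L⊆MechV {Y} Y∈L with c , mechY ← well-spread⇒mechanical (proj₁ (proj₁ (qvL Y∈L))) (proj₂ (qvL Y∈L)) =
      subst (_∈ map (Mech K) V) (sym Y≡) (∈-map⁺ (Mech K) (Equivalence.from (∈V⇔ (m%n<n c n)) (subst (_∈ L) Y≡ Y∈L)))
      where
      Y≡ : Y ≡ Mech K (c % n)
      Y≡ = mechanical-ext (mechanical-≈ (≈-sym (%-≈ c)) mechY) (Mech-mechanical K (c % n))

    k≤∣V∣ : k ≤ length V
    k≤∣V∣ = begin
      k                          ≡⟨ length-applyUpTo (Mech K) k ⟨
      length star                ≤⟨ proj₂ maxL star star-independent ⟩
      length L                   ≤⟨ length-≤-injection id uniqL (λ _ _ → id) L⊆MechV ⟩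
      length (map (Mech K) V)    ≡⟨ length-map (Mech K) V ⟩
      length V                   ∎
      where open ≤-Reasoning

    V-near : ∀ {v w} → v ∈ V → w ∈ V → v ≢ w → Near v w
    V-near {v} {w} v∈V w∈V v≢w = mechanical-meet (Mech-mechanical K v) (Mech-mechanical K w)
      (meetL (Equivalence.to (∈V⇔ v<n) v∈V) (Equivalence.to (∈V⇔ w<n) w∈V) (v≢w ∘ Mech-injective v<n w<n))
      where
      v<n : v < n
      v<n = All.lookup V<n v∈V
      w<n : w < n
      w<n = All.lookup V<n w∈V

    private
      X₀-mechanical : ∃[ c ] Mechanical K c X₀
      X₀-mechanical = well-spread⇒mechanical (proj₁ (proj₁ qX₀)) (proj₂ qX₀)

      c₀ : ℕ
      c₀ = proj₁ X₀-mechanical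

      V-arc : ∃[ f ] ∀ {v} → v < n → (v ∈ V ⇔ (v + f) % n < k)
      V-arc = near⇒arc 1≤k k<K⊎k≡1 (filter⁺ (λ v → Mech K v ∈? L) (upTo⁺ n)) V<n k≤∣V∣ V-near

      f : ℕ
      f = proj₁ V-arc

      ρ^X₀≡ : ∀ x → ρ^ x X₀ ≡ Mech K ((c₀ + x * k) % n)
      ρ^X₀≡ x = mechanical-ext (mechanical-≈ (≈-sym (%-≈ (c₀ + x * k))) (mechanical-ρ^ x (proj₂ X₀-mechanical)))
        (Mech-mechanical K ((c₀ + x * k) % n))

      T-membership : ∀ x → x < n → (at T x ≡ true ⇔ (c₀ + f + x * k) % n < k)
      T-membership x x<n = begin
        at T x ≡ true                   ≡⟨ cong (_≡ true) (trans (cong (at T) (sym (toℕ-fromℕ< x<n))) (at-toℕ T t)) ⟩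
        lookup T t ≡ true               ≈⟨ mk⇔ (lookup⇒[]= t T) []=⇒lookup ⟩
        t ∈ₛ T                          ≈⟨ corr t ⟩
        ρ^ (toℕ t) X₀ ∈ L               ≡⟨ cong (λ y → ρ^ y X₀ ∈ L) (toℕ-fromℕ< x<n) ⟩
        ρ^ x X₀ ∈ L                     ≡⟨ cong (_∈ L) (ρ^X₀≡ x) ⟩
        Mech K w ∈ L                    ≈⟨ ⇔-sym (∈V⇔ w<n) ⟩
        w ∈ V                           ≈⟨ proj₂ V-arc w<n ⟩
        (w + f) % n < k                 ≡⟨ cong (_< k) (+-≈ (%-≈ (c₀ + x * k)) (≈-refl {f}) .%≡%) ⟩
        (c₀ + x * k + f) % n < k        ≡⟨ cong (λ y → y % n < k) (+-CS.xy∙z≈xz∙y c₀ (x * k) f) ⟩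
        (c₀ + f + x * k) % n < k        ∎
        where
        open ⇔-Reasoning
        t : Fin n
        t = fromℕ< x<n
        w : ℕ
        w = (c₀ + x * k) % n
        w<n : w < n
        w<n = m%n<n (c₀ + x * k) n

    T-well-spread : WellSpread T
    T-well-spread = mechanical⇒WellSpread (mechanical-from-⇔ {k} {c₀ + f} {T} T-membership)

private
  2k≤n⇒n≡1+k+K′ : ∀ {n k} → 1 ≤ k → 2 * k ≤ n → ∃[ K′ ] suc (k + K′) ≡ n × k ≤ suc K′
  2k≤n⇒n≡1+k+K′ {n} {k} 1≤k 2k≤n =
    K′ , n≡ , +-cancelˡ-≤ k k (suc K′) (subst (k + k ≤_) (sym (trans (+-suc k K′) n≡)) k+k≤n)
    where
    k+k≤n : k + k ≤ n
    k+k≤n = subst (_≤ n) (cong (k +_) (+-identityʳ k)) 2k≤n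
    1+k≤n : suc k ≤ n
    1+k≤n = ≤-trans (≤-reflexive (+-comm 1 k)) (≤-trans (+-monoʳ-≤ k 1≤k) k+k≤n)
    K′ : ℕ
    K′ = n ∸ suc k
    n≡ : suc (k + K′) ≡ n
    n≡ = m+[n∸m]≡n 1+k≤n

lemma16 : (n k : ℕ) → 1 ≤ k → 2 * k ≤ n → gcd n k ≡ 1 →
    (X₀ : Subset n) → QVertex n k X₀ →
    (L : List (Subset n)) → MaxIndepQ n k L →
    (T : Subset n) → Corresponds X₀ L T →
    WellSpread T
lemma16 n k 1≤k 2k≤n gcd≡1 X₀ qX₀ L maxL T corr with K′ , refl , k≤K ← 2k≤n⇒n≡1+k+K′ 1≤k 2k≤n =
  Correspondence.T-well-spread k K′ (gcd≡1⇒coprime gcd≡1) 1≤k k≤K qX₀ maxL corr
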